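{- Let $k\ge 2$, $q\ge 1$ be integers. The restriction of $\phi$ to $W_{k,q}$ is a bijection onto $\Delta_{k,q}\cap\mathbb{Z}^k$ and is a graph isomorphism from $G_k''$ to $G_k$; in particular $G_k''$ is isomorphic to $G_k$.
   Context: $R_{k,q}=\{y\in\mathbb{R}^{k-1}: 0\le y_1\le\dots\le y_{k-1}\le q\}$, $W_{k,q}=R_{k,q}\cap\mathbb{Z}^{k-1}$, $\Delta_{k,q}=\{x\in\mathbb{R}^k: x_i\ge0,\ \sum_i x_i=q\}$. $\phi:R_{k,q}\to\Delta_{k,q}$, $\phi(y)=(y_1,y_2-y_1,\dots,y_{k-1}-y_{k-2},q-y_{k-1})$. $G_k''$ has vertex set $W_{k,q}$, with distinct $w^1,w^2$ adjacent iff either $(w^1-w^2)_i\in\{0,1\}$ for all $i=1,\dots,k-1$, or $(w^1-w^2)_i\in\{ -1,0\}$ for all $i$. $G_k$ has vertex set $\Delta_{k,q}\cap\mathbb{Z}^k$, with distinct $v^1,v^2$ adjacent iff $(v^1-v^2)_i\in\{ -1,0,1\}$ for all $i=1,\dots,k$, the numbers of entries equal to $1$ and to $-1$ are equal, and reading the nonzero entries from left to right their signs alternate. -}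

module Defs where

open import Data.Nat using (ℕ; suc)
open import Data.Integer using (ℤ; 0ℤ; 1ℤ; -1ℤ; _+_; _-_; _≤_; _<_; _≟_)
open import Data.Fin using (Fin; suc; inject₁)
open import Data.Vec using (Vec; _∷_; []; _∷ʳ_; lookup; tabulate; foldr; toList)
open import Data.List using (List; filter; length)
import Data.List as L
open import Data.Unit using (⊤)
open import Data.Product using (_×_)
open import Data.Sum using (_⊎_)
open import Relation.Nullary using (¬_)
open import Relation.Nullary.Decidable using (¬?)
open import Relation.Binary.PropositionalEquality using (_≡_; _≢_)

-- Throughout, k = suc n, so points of W_{k,q} are vectors of length n = k-1
-- and points of Δ_{k,q} ∩ ℤ^k are vectors of length suc n = k.

ext : {n : ℕ} → ℤ → Vec ℤ n → Vec ℤ (suc (suc n))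
ext q y = 0ℤ ∷ (y ∷ʳ q)

InW : (n : ℕ) → ℤ → Vec ℤ n → Set
InW n q y = ∀ (i : Fin (suc n)) → lookup (ext q y) (inject₁ i) ≤ lookup (ext q y) (suc i)

sumℤ : {m : ℕ} → Vec ℤ m → ℤ
sumℤ = foldr _ _+_ 0ℤ

InΔ : (n : ℕ) → ℤ → Vec ℤ (suc n) → Set
InΔ n q x = (∀ (i : Fin (suc n)) → 0ℤ ≤ lookup x i) × sumℤ x ≡ q

φ : (n : ℕ) → ℤ → Vec ℤ n → Vec ℤ (suc n)
φ n q y = tabulate (λ i → lookup (ext q y) (suc i) - lookup (ext q y) (inject₁ i))

diff : {m : ℕ} → Vec ℤ m → Vec ℤ m → Vec ℤ m
diff {m} a b = tabulate (λ i → lookup a i - lookup b i)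

AdjG'' : (n : ℕ) → Vec ℤ n → Vec ℤ n → Set
AdjG'' n w1 w2 =
  w1 ≢ w2 ×
  ((∀ (i : Fin n) → lookup (diff w1 w2) i ≡ 0ℤ ⊎ lookup (diff w1 w2) i ≡ 1ℤ)
   ⊎ (∀ (i : Fin n) → lookup (diff w1 w2) i ≡ -1ℤ ⊎ lookup (diff w1 w2) i ≡ 0ℤ))

SignsAlternate : List ℤ → Set
SignsAlternate L.[] = ⊤
SignsAlternate (x L.∷ L.[]) = ⊤
SignsAlternate (x L.∷ y L.∷ l) =
  ((0ℤ < x × y < 0ℤ) ⊎ (x < 0ℤ × 0ℤ < y)) × SignsAlternate (y L.∷ l)

AdjG : (n : ℕ) → Vec ℤ (suc n) → Vec ℤ (suc n) → Set
AdjG n v1 v2 =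
  v1 ≢ v2 ×
  (∀ (i : Fin (suc n)) → lookup d i ≡ -1ℤ ⊎ lookup d i ≡ 0ℤ ⊎ lookup d i ≡ 1ℤ) ×
  length (filter (λ z → z ≟ 1ℤ) (toList d)) ≡ length (filter (λ z → z ≟ -1ℤ) (toList d)) ×
  SignsAlternate (filter (λ z → ¬? (z ≟ 0ℤ)) (toList d))
  where d = diff v1 v2

{-# OPTIONS --safe #-}
-- φ sends y to the steps of the walk 0, y₁, …, y_{k−1}, q, so it matches monotone walks with
-- nonnegative step vectors summing to q; partial sums invert it. Being affine, φ sends
-- y₁ − y₂ to the steps of the closed walk 0, y₁ − y₂, 0. A closed walk through 0 stays in
-- {0, 1} or in {−1, 0} exactly when its steps lie in {−1, 0, 1} and its nonzero steps
-- alternate in sign (the band {−1, 0} reduces to {0, 1} by shifting the walk up by one).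
-- The +1 and −1 steps are then equally many, because the steps of a closed walk sum to 0.
module Submission where

open import Defs
open import Data.Nat using (ℕ; _≤_; suc; s≤s; z≤n)
open import Data.Integer using (ℤ; +_; 0ℤ; 1ℤ; -1ℤ; _+_; _-_; _⊖_; _≟_; +<+; -<+)
import Data.Integer as Z
open import Data.Integer.Properties
  using (+-identityˡ; +-identityʳ; +-inverseʳ; +-assoc; +-injective; <-cmp; pred-suc;
         i≤j⇒0≤j-i; 0≤i-j⇒j≤i; i-j≡0⇒i≡j; [+m]-[+n]≡m⊖n; distribʳ-⊖-+-pos; distribʳ-⊖-+-neg)
open import Data.Integer.Tactic.RingSolver using (solve-∀)
open import Data.Fin using (inject₁) renaming (suc to fsuc)
open import Data.Vec using (Vec; []; _∷_; _∷ʳ_; head; lookup; tabulate; toList; map)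
open import Data.Vec.Properties using (∷-injective; ∷ʳ-injectiveˡ; lookup∘tabulate; map-∷ʳ)
open import Data.Vec.Relation.Unary.All using (All; []; _∷_)
import Data.Vec.Relation.Unary.All as All
open import Data.Vec.Relation.Unary.All.Properties using (lookup⁺; lookup⁻; map⁺; map⁻)
open import Data.List using (List; filter; length)
import Data.List as L
import Data.List.Relation.Unary.All as ListAll
open import Data.List.Relation.Unary.All.Properties using (all-filter)
open import Data.Product using (_×_; _,_; Σ)
open import Data.Sum using (_⊎_; inj₁; inj₂)
open import Data.Unit using (tt)
open import Function using (_∘_)
open import Function.Bundles using (_⇔_; mk⇔)
open import Relation.Nullary using (¬_; contradiction)
open import Relation.Nullary.Decidable using (¬?)
open import Relation.Binary.Definitions using (tri<; tri≈; tri>)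
open import Relation.Binary.PropositionalEquality
  using (_≡_; _≢_; refl; sym; trans; cong; cong₂; subst; module ≡-Reasoning)
open ≡-Reasoning

private variable
  m n : ℕ

i-j≡k⇒i≡k+j : ∀ {i j k} → i - j ≡ k → i ≡ k + j
i-j≡k⇒i≡k+j {i} {j} refl = i≡i-j+j i j
  where
  i≡i-j+j : ∀ i j → i ≡ (i - j) + j
  i≡i-j+j = solve-∀

differences : Vec ℤ (suc m) → Vec ℤ m
differences (a ∷ []) = []
differences (a ∷ b ∷ v) = (b - a) ∷ differences (b ∷ v)

tabulate-differences : (v : Vec ℤ (suc m)) →
  tabulate (λ i → lookup v (fsuc i) - lookup v (inject₁ i)) ≡ differences v
tabulate-differences (a ∷ []) = refl
tabulate-differences (a ∷ b ∷ v) = cong ((b - a) ∷_) (tabulate-differences (b ∷ v))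

sum-differences : ∀ a (v : Vec ℤ m) z → sumℤ (differences (a ∷ (v ∷ʳ z))) ≡ z - a
sum-differences a [] z = +-identityʳ (z - a)
sum-differences a (b ∷ v) z = begin
  (b - a) + sumℤ (differences (b ∷ (v ∷ʳ z))) ≡⟨ cong (λ s → (b - a) + s) (sum-differences b v z) ⟩
  (b - a) + (z - b)                           ≡⟨ telescope a b z ⟩
  z - a                                       ∎
  where
  telescope : ∀ a b z → (b - a) + (z - b) ≡ z - a
  telescope = solve-∀

differences-injective : ∀ a (v w : Vec ℤ m) → differences (a ∷ v) ≡ differences (a ∷ w) → v ≡ w
differences-injective a [] [] _ = refl
differences-injective a (b ∷ v) (c ∷ w) eq with ∷-injective eq
... | b-a≡c-a , eq′ with trans (i-j≡k⇒i≡k+j {b} b-a≡c-a) (sym (i-j≡k⇒i≡k+j {c} {a} refl))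
... | refl = cong (b ∷_) (differences-injective b v w eq′)

-- The full sum is left out: it is the endpoint z appended in differences-partialSums.
partialSums : ℤ → Vec ℤ (suc m) → Vec ℤ m
partialSums a (c ∷ []) = []
partialSums a (c ∷ c′ ∷ x) = (a + c) ∷ partialSums (a + c) (c′ ∷ x)

differences-partialSums : ∀ a (x : Vec ℤ (suc m)) z → a + sumℤ x ≡ z →
  differences (a ∷ (partialSums a x ∷ʳ z)) ≡ x
differences-partialSums a (c ∷ []) _ refl = cong (_∷ []) (a+[c+0]-a≡c a c)
  where
  a+[c+0]-a≡c : ∀ a c → (a + (c + 0ℤ)) - a ≡ c
  a+[c+0]-a≡c = solve-∀
differences-partialSums a (c ∷ c′ ∷ x) z eq =
  cong₂ _∷_ (a+c-a≡c a c) (differences-partialSums (a + c) (c′ ∷ x) z (trans (+-assoc a c _) eq))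
  where
  a+c-a≡c : ∀ a c → (a + c) - a ≡ c
  a+c-a≡c = solve-∀

differences-shift : ∀ k (w : Vec ℤ (suc m)) → differences (map (λ x → k + x) w) ≡ differences w
differences-shift k (a ∷ []) = refl
differences-shift k (a ∷ b ∷ w) = cong₂ _∷_ (k+b-[k+a]≡b-a k a b) (differences-shift k (b ∷ w))
  where
  k+b-[k+a]≡b-a : ∀ k a b → (k + b) - (k + a) ≡ b - a
  k+b-[k+a]≡b-a = solve-∀

diff-differences : (u v : Vec ℤ (suc m)) → diff (differences u) (differences v) ≡ differences (diff u v)
diff-differences (a ∷ []) (a′ ∷ []) = refl
diff-differences (a ∷ b ∷ u) (a′ ∷ b′ ∷ v) =
  cong₂ _∷_ (exchange a b a′ b′) (diff-differences (b ∷ u) (b′ ∷ v))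
  where
  exchange : ∀ a b a′ b′ → (b - a) - (b′ - a′) ≡ (b - b′) - (a - a′)
  exchange = solve-∀

diff-∷ʳ : (u v : Vec ℤ m) (x y : ℤ) → diff (u ∷ʳ x) (v ∷ʳ y) ≡ diff u v ∷ʳ (x - y)
diff-∷ʳ [] [] x y = refl
diff-∷ʳ (a ∷ u) (b ∷ v) x y = cong ((a - b) ∷_) (diff-∷ʳ u v x y)

∷ʳ⁺ : ∀ {A : Set} {P : A → Set} {v : Vec A m} {x} → All P v → P x → All P (v ∷ʳ x)
∷ʳ⁺ [] px = px ∷ []
∷ʳ⁺ (pa ∷ pv) px = pa ∷ ∷ʳ⁺ pv px

∷ʳ⁻ : ∀ {A : Set} {P : A → Set} (v : Vec A m) {x} → All P (v ∷ʳ x) → All P v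
∷ʳ⁻ [] _ = []
∷ʳ⁻ (a ∷ v) (pa ∷ pv) = pa ∷ ∷ʳ⁻ v pv

closedWalk : ℤ → Vec ℤ n → Vec ℤ (suc (suc n))
closedWalk c e = c ∷ (e ∷ʳ c)

Is01 Is-10 IsSign : ℤ → Set
Is01 x = x ≡ 0ℤ ⊎ x ≡ 1ℤ
Is-10 x = x ≡ -1ℤ ⊎ x ≡ 0ℤ
IsSign x = x ≡ -1ℤ ⊎ x ≡ 0ℤ ⊎ x ≡ 1ℤ

Is-10⇒Is01-suc : ∀ {x} → Is-10 x → Is01 (Z.suc x)
Is-10⇒Is01-suc (inj₁ refl) = inj₁ refl
Is-10⇒Is01-suc (inj₂ refl) = inj₂ refl

Is01-suc⇒Is-10 : ∀ {x} → Is01 (Z.suc x) → Is-10 x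
Is01-suc⇒Is-10 {x} (inj₁ eq) = inj₁ (trans (sym (pred-suc x)) (cong Z.pred eq))
Is01-suc⇒Is-10 {x} (inj₂ eq) = inj₂ (trans (sym (pred-suc x)) (cong Z.pred eq))

Is01-step : ∀ {a b} → Is01 a → Is01 b → IsSign (b - a)
Is01-step (inj₁ refl) (inj₁ refl) = inj₂ (inj₁ refl)
Is01-step (inj₁ refl) (inj₂ refl) = inj₂ (inj₂ refl)
Is01-step (inj₂ refl) (inj₁ refl) = inj₁ refl
Is01-step (inj₂ refl) (inj₂ refl) = inj₂ (inj₁ refl)

IsSign-step : ∀ {a b} → IsSign (b - a) → b ≡ -1ℤ + a ⊎ b ≡ 0ℤ + a ⊎ b ≡ 1ℤ + a
IsSign-step (inj₁ eq) = inj₁ (i-j≡k⇒i≡k+j eq)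
IsSign-step (inj₂ (inj₁ eq)) = inj₂ (inj₁ (i-j≡k⇒i≡k+j eq))
IsSign-step (inj₂ (inj₂ eq)) = inj₂ (inj₂ (i-j≡k⇒i≡k+j eq))

nonzeros : List ℤ → List ℤ
nonzeros = filter (λ z → ¬? (z ≟ 0ℤ))

count : ℤ → List ℤ → ℕ
count x l = length (filter (λ z → z ≟ x) l)

-- AdjG'' n w₁ w₂ unfolds to w₁ ≢ w₂ × G''-Difference (diff w₁ w₂),
-- and AdjG n v₁ v₂ to v₁ ≢ v₂ × G-Difference (diff v₁ v₂).
G''-Difference : Vec ℤ n → Set
G''-Difference e = (∀ i → Is01 (lookup e i)) ⊎ (∀ i → Is-10 (lookup e i))

G-Difference : Vec ℤ (suc n) → Set
G-Difference d =
  (∀ i → IsSign (lookup d i)) ×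
  count 1ℤ (toList d) ≡ count -1ℤ (toList d) ×
  SignsAlternate (nonzeros (toList d))

count-balance : (d : Vec ℤ m) → All IsSign d → count 1ℤ (toList d) ⊖ count -1ℤ (toList d) ≡ sumℤ d
count-balance [] [] = refl
count-balance (_ ∷ d) (inj₁ refl ∷ signs) =
  trans (sym (distribʳ-⊖-+-neg 0 (count 1ℤ (toList d)) (count -1ℤ (toList d))))
        (cong (λ s → -1ℤ + s) (count-balance d signs))
count-balance (_ ∷ d) (inj₂ (inj₁ refl) ∷ signs) =
  trans (count-balance d signs) (sym (+-identityˡ (sumℤ d)))
count-balance (_ ∷ d) (inj₂ (inj₂ refl) ∷ signs) =
  trans (sym (distribʳ-⊖-+-pos 1 (count 1ℤ (toList d)) (count -1ℤ (toList d))))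
        (cong (λ s → 1ℤ + s) (count-balance d signs))

count-balanced : (d : Vec ℤ m) → All IsSign d → sumℤ d ≡ 0ℤ → count 1ℤ (toList d) ≡ count -1ℤ (toList d)
count-balanced d signs sum≡0 = +-injective (i-j≡0⇒i≡j (+ c₊) (+ c₋) (begin
  + c₊ - + c₋ ≡⟨ [+m]-[+n]≡m⊖n c₊ c₋ ⟩
  c₊ ⊖ c₋     ≡⟨ count-balance d signs ⟩
  sumℤ d      ≡⟨ sum≡0 ⟩
  0ℤ          ∎))
  where
  c₊ c₋ : ℕ
  c₊ = count 1ℤ (toList d)
  c₋ = count -1ℤ (toList d)

0<1 : 0ℤ Z.< 1ℤ
0<1 = +<+ (s≤s z≤n)

-1<0 : -1ℤ Z.< 0ℤ
-1<0 = -<+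

SignsAlternate-tail : ∀ x l → SignsAlternate (x L.∷ l) → SignsAlternate l
SignsAlternate-tail x L.[] _ = tt
SignsAlternate-tail x (y L.∷ l) (_ , alt) = alt

¬SignsAlternate-−1−1 : ∀ l → ¬ SignsAlternate (-1ℤ L.∷ -1ℤ L.∷ l)
¬SignsAlternate-−1−1 l (inj₁ (() , _) , _)
¬SignsAlternate-−1−1 l (inj₂ (_ , ()) , _)

¬SignsAlternate-11 : ∀ l → ¬ SignsAlternate (1ℤ L.∷ 1ℤ L.∷ l)
¬SignsAlternate-11 l (inj₁ (_ , +<+ ()) , _)
¬SignsAlternate-11 l (inj₂ (+<+ () , _) , _)

SignsAlternate-extend : ∀ l → ListAll.All (_≢ 0ℤ) l → SignsAlternate l →
  SignsAlternate (-1ℤ L.∷ l) ⊎ SignsAlternate (1ℤ L.∷ l)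
SignsAlternate-extend L.[] _ _ = inj₁ tt
SignsAlternate-extend (x L.∷ l) (x≢0 ListAll.∷ _) alt with <-cmp x 0ℤ
... | tri< x<0 _ _ = inj₂ (inj₁ (0<1 , x<0) , alt)
... | tri≈ _ x≡0 _ = contradiction x≡0 x≢0
... | tri> _ _ x>0 = inj₁ (inj₂ (-1<0 , x>0) , alt)

band-walk-steps : (w : Vec ℤ (suc m)) → All Is01 w → All IsSign (differences w)
band-walk-steps (a ∷ []) _ = []
band-walk-steps (a ∷ b ∷ w) (a∈01 ∷ b∈01 ∷ w∈01) =
  Is01-step a∈01 b∈01 ∷ band-walk-steps (b ∷ w) (b∈01 ∷ w∈01)

-- 1 − a is the other level of the band {0, 1}; prepending it adds a virtual step into a,
-- and alternation including that step is the invariant the induction needs.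
band-walk-alternates : (w : Vec ℤ (suc m)) → All Is01 w →
  SignsAlternate (nonzeros (toList (differences ((1ℤ - head w) ∷ w))))
band-walk-alternates (_ ∷ []) (inj₁ refl ∷ []) = tt
band-walk-alternates (_ ∷ []) (inj₂ refl ∷ []) = tt
band-walk-alternates (_ ∷ _ ∷ w) (inj₁ refl ∷ inj₁ refl ∷ w∈01) =
  band-walk-alternates (0ℤ ∷ w) (inj₁ refl ∷ w∈01)
band-walk-alternates (_ ∷ _ ∷ w) (inj₁ refl ∷ inj₂ refl ∷ w∈01) =
  inj₂ (-1<0 , 0<1) , band-walk-alternates (1ℤ ∷ w) (inj₂ refl ∷ w∈01)
band-walk-alternates (_ ∷ _ ∷ w) (inj₂ refl ∷ inj₁ refl ∷ w∈01) =
  inj₁ (0<1 , -1<0) , band-walk-alternates (0ℤ ∷ w) (inj₁ refl ∷ w∈01)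
band-walk-alternates (_ ∷ _ ∷ w) (inj₂ refl ∷ inj₂ refl ∷ w∈01) =
  band-walk-alternates (1ℤ ∷ w) (inj₂ refl ∷ w∈01)

alternating-walk-in-band : (w : Vec ℤ (suc m)) → Is01 (head w) → All IsSign (differences w) →
  SignsAlternate (nonzeros (toList (differences ((1ℤ - head w) ∷ w)))) → All Is01 w
alternating-walk-in-band (_ ∷ []) a∈01 [] _ = a∈01 ∷ []
alternating-walk-in-band (_ ∷ b ∷ w) (inj₁ refl) (step ∷ steps) alt with IsSign-step {0ℤ} {b} step
... | inj₁ refl = contradiction alt (¬SignsAlternate-−1−1 _)
... | inj₂ (inj₁ refl) = inj₁ refl ∷ alternating-walk-in-band (0ℤ ∷ w) (inj₁ refl) steps alt
... | inj₂ (inj₂ refl) =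
  inj₁ refl ∷ alternating-walk-in-band (1ℤ ∷ w) (inj₂ refl) steps (SignsAlternate-tail _ _ alt)
alternating-walk-in-band (_ ∷ b ∷ w) (inj₂ refl) (step ∷ steps) alt with IsSign-step {1ℤ} {b} step
... | inj₁ refl =
  inj₂ refl ∷ alternating-walk-in-band (0ℤ ∷ w) (inj₁ refl) steps (SignsAlternate-tail _ _ alt)
... | inj₂ (inj₁ refl) = inj₂ refl ∷ alternating-walk-in-band (1ℤ ∷ w) (inj₂ refl) steps alt
... | inj₂ (inj₂ refl) = contradiction alt (¬SignsAlternate-11 _)

differences-closedWalk-suc : (e : Vec ℤ n) →
  differences (closedWalk 1ℤ (map Z.suc e)) ≡ differences (closedWalk 0ℤ e)
differences-closedWalk-suc e = begin
  differences (1ℤ ∷ (map Z.suc e ∷ʳ 1ℤ))    ≡⟨ cong (λ v → differences (1ℤ ∷ v)) (sym (map-∷ʳ Z.suc 0ℤ e)) ⟩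
  differences (map Z.suc (closedWalk 0ℤ e)) ≡⟨ differences-shift 1ℤ (closedWalk 0ℤ e) ⟩
  differences (closedWalk 0ℤ e)             ∎

closed-band-walk⇒G-Difference : ∀ c (e : Vec ℤ n) → Is01 c → All Is01 e →
  G-Difference (differences (closedWalk c e))
closed-band-walk⇒G-Difference c e c∈01 e∈01 =
  lookup⁺ steps ,
  count-balanced (differences (closedWalk c e)) steps (trans (sum-differences c e c) (+-inverseʳ c)) ,
  alternates c∈01 (band-walk-alternates (closedWalk c e) walk∈01)
  where
  walk∈01 : All Is01 (closedWalk c e)
  walk∈01 = c∈01 ∷ ∷ʳ⁺ e∈01 c∈01
  steps : All IsSign (differences (closedWalk c e))
  steps = band-walk-steps (closedWalk c e) walk∈01
  alternates : Is01 c → SignsAlternate (nonzeros (toList (differences ((1ℤ - c) ∷ closedWalk c e)))) →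
    SignsAlternate (nonzeros (toList (differences (closedWalk c e))))
  alternates (inj₁ refl) = SignsAlternate-tail _ _
  alternates (inj₂ refl) = SignsAlternate-tail _ _

alternating-closed-walk⇒band : ∀ c (e : Vec ℤ n) → Is01 c → All IsSign (differences (closedWalk c e)) →
  SignsAlternate (nonzeros (toList (differences ((1ℤ - c) ∷ closedWalk c e)))) → All Is01 e
alternating-closed-walk⇒band c e c∈01 steps alt =
  ∷ʳ⁻ e (All.tail (alternating-walk-in-band (closedWalk c e) c∈01 steps alt))

φ≡differences∘ext : ∀ n q (y : Vec ℤ n) → φ n q y ≡ differences (ext q y)
φ≡differences∘ext n q y = tabulate-differences (ext q y)

lookup-φ : ∀ n q (y : Vec ℤ n) i →
  lookup (φ n q y) i ≡ lookup (ext q y) (fsuc i) - lookup (ext q y) (inject₁ i)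
lookup-φ n q y = lookup∘tabulate _

InW⇒φ-nonnegative : ∀ n q (y : Vec ℤ n) → InW n q y → ∀ i → 0ℤ Z.≤ lookup (φ n q y) i
InW⇒φ-nonnegative n q y w i = subst (0ℤ Z.≤_) (sym (lookup-φ n q y i)) (i≤j⇒0≤j-i (w i))

φ-nonnegative⇒InW : ∀ n q (y : Vec ℤ n) → (∀ i → 0ℤ Z.≤ lookup (φ n q y) i) → InW n q y
φ-nonnegative⇒InW n q y h i = 0≤i-j⇒j≤i (subst (0ℤ Z.≤_) (lookup-φ n q y i) (h i))

sum-φ : ∀ n q (y : Vec ℤ n) → sumℤ (φ n q y) ≡ q
sum-φ n q y = begin
  sumℤ (φ n q y)               ≡⟨ cong sumℤ (φ≡differences∘ext n q y) ⟩
  sumℤ (differences (ext q y)) ≡⟨ sum-differences 0ℤ y q ⟩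
  q - 0ℤ                       ≡⟨ +-identityʳ q ⟩
  q                            ∎

φ-W⊆Δ : ∀ n q (y : Vec ℤ n) → InW n q y → InΔ n q (φ n q y)
φ-W⊆Δ n q y w = InW⇒φ-nonnegative n q y w , sum-φ n q y

φ-injective : ∀ n q (y₁ y₂ : Vec ℤ n) → φ n q y₁ ≡ φ n q y₂ → y₁ ≡ y₂
φ-injective n q y₁ y₂ eq = ∷ʳ-injectiveˡ y₁ y₂ (differences-injective 0ℤ (y₁ ∷ʳ q) (y₂ ∷ʳ q) (begin
  differences (ext q y₁) ≡⟨ sym (φ≡differences∘ext n q y₁) ⟩
  φ n q y₁               ≡⟨ eq ⟩
  φ n q y₂               ≡⟨ φ≡differences∘ext n q y₂ ⟩
  differences (ext q y₂) ∎))

φ-Δ⊆image-W : ∀ n q (x : Vec ℤ (suc n)) → InΔ n q x → Σ (Vec ℤ n) (λ y → InW n q y × φ n q y ≡ x)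
φ-Δ⊆image-W n q x (x≥0 , Σx≡q) =
  y , φ-nonnegative⇒InW n q y (λ i → subst (λ v → 0ℤ Z.≤ lookup v i) (sym φy≡x) (x≥0 i)) , φy≡x
  where
  y : Vec ℤ n
  y = partialSums 0ℤ x
  φy≡x : φ n q y ≡ x
  φy≡x = trans (φ≡differences∘ext n q y) (differences-partialSums 0ℤ x q (trans (+-identityˡ _) Σx≡q))

diff-ext : ∀ q (y₁ y₂ : Vec ℤ n) → diff (ext q y₁) (ext q y₂) ≡ closedWalk 0ℤ (diff y₁ y₂)
diff-ext q y₁ y₂ = cong (0ℤ ∷_) (trans (diff-∷ʳ y₁ y₂ q q) (cong (diff y₁ y₂ ∷ʳ_) (+-inverseʳ q)))

diff-φ : ∀ n q (y₁ y₂ : Vec ℤ n) → diff (φ n q y₁) (φ n q y₂) ≡ differences (closedWalk 0ℤ (diff y₁ y₂))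
diff-φ n q y₁ y₂ = begin
  diff (φ n q y₁) (φ n q y₂)
    ≡⟨ cong₂ diff (φ≡differences∘ext n q y₁) (φ≡differences∘ext n q y₂) ⟩
  diff (differences (ext q y₁)) (differences (ext q y₂)) ≡⟨ diff-differences (ext q y₁) (ext q y₂) ⟩
  differences (diff (ext q y₁) (ext q y₂))               ≡⟨ cong differences (diff-ext q y₁ y₂) ⟩
  differences (closedWalk 0ℤ (diff y₁ y₂))               ∎

G''-Difference⇒G-Difference : (e : Vec ℤ n) → G''-Difference e → G-Difference (differences (closedWalk 0ℤ e))
G''-Difference⇒G-Difference e (inj₁ e∈01) = closed-band-walk⇒G-Difference 0ℤ e (inj₁ refl) (lookup⁻ e∈01)
G''-Difference⇒G-Difference e (inj₂ e∈-10) =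
  subst G-Difference (differences-closedWalk-suc e)
    (closed-band-walk⇒G-Difference 1ℤ (map Z.suc e) (inj₂ refl) e+1∈01)
  where
  e+1∈01 : All Is01 (map Z.suc e)
  e+1∈01 = map⁺ (All.map (λ {x} → Is-10⇒Is01-suc {x}) (lookup⁻ e∈-10))

G-Difference⇒G''-Difference : (e : Vec ℤ n) → G-Difference (differences (closedWalk 0ℤ e)) → G''-Difference e
G-Difference⇒G''-Difference e (steps , _ , alt)
  with SignsAlternate-extend _ (all-filter (λ z → ¬? (z ≟ 0ℤ)) (toList (differences (closedWalk 0ℤ e)))) alt
... | inj₁ alt₋ = inj₁ (lookup⁺ (alternating-closed-walk⇒band 0ℤ e (inj₁ refl) (lookup⁻ steps) alt₋))
... | inj₂ alt₊ = inj₂ (lookup⁺ (All.map (λ {x} → Is01-suc⇒Is-10 {x}) (map⁻ e+1∈01)))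
  where
  shift : differences (closedWalk 0ℤ e) ≡ differences (closedWalk 1ℤ (map Z.suc e))
  shift = sym (differences-closedWalk-suc e)
  e+1∈01 : All Is01 (map Z.suc e)
  e+1∈01 = alternating-closed-walk⇒band 1ℤ (map Z.suc e) (inj₂ refl)
    (subst (All IsSign) shift (lookup⁻ steps))
    (subst (λ d → SignsAlternate (1ℤ L.∷ nonzeros (toList d))) shift alt₊)

φ-adjacency : ∀ n q (y₁ y₂ : Vec ℤ n) → AdjG'' n y₁ y₂ ⇔ AdjG n (φ n q y₁) (φ n q y₂)
φ-adjacency n q y₁ y₂ = mk⇔
  (λ (y₁≢y₂ , adj) → y₁≢y₂ ∘ φ-injective n q y₁ y₂ ,
    subst G-Difference (sym (diff-φ n q y₁ y₂)) (G''-Difference⇒G-Difference (diff y₁ y₂) adj))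
  (λ (φy₁≢φy₂ , adj) → φy₁≢φy₂ ∘ cong (φ n q) ,
    G-Difference⇒G''-Difference (diff y₁ y₂) (subst G-Difference (diff-φ n q y₁ y₂) adj))

proposition3p14 : (n : ℕ) → 1 ≤ n → (q : ℕ) → 1 ≤ q →
    (∀ (y : Vec ℤ n) → InW n (+ q) y → InΔ n (+ q) (φ n (+ q) y)) ×
    (∀ (y₁ y₂ : Vec ℤ n) → InW n (+ q) y₁ → InW n (+ q) y₂ →
      φ n (+ q) y₁ ≡ φ n (+ q) y₂ → y₁ ≡ y₂) ×
    (∀ (x : Vec ℤ (Data.Nat.suc n)) → InΔ n (+ q) x →
      Σ (Vec ℤ n) (λ y → InW n (+ q) y × φ n (+ q) y ≡ x)) ×
    (∀ (y₁ y₂ : Vec ℤ n) → InW n (+ q) y₁ → InW n (+ q) y₂ →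
      AdjG'' n y₁ y₂ ⇔ AdjG n (φ n (+ q) y₁) (φ n (+ q) y₂))
proposition3p14 n _ q _ =
  φ-W⊆Δ n (+ q) ,
  (λ y₁ y₂ _ _ → φ-injective n (+ q) y₁ y₂) ,
  φ-Δ⊆image-W n (+ q) ,
  (λ y₁ y₂ _ _ → φ-adjacency n (+ q) y₁ y₂)
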